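{- Let $p$ be a prime, let $G_n$ be a multigraph with vertices $v_1,\dots,v_n$ and adjacency matrix $\Gamma$, and let $\Lambda=[I_n\,|\,\Gamma]$ be the $n\times 2n$ matrix over $\mathbb{Z}/p\mathbb{Z}$. Then the diagonal distance of $G_n$ over $\mathbb{Z}/p\mathbb{Z}$ satisfies $$\Delta(G_n)=\min\left\{\sum_{i=1}^n \chi(k_i)>0 \;\middle|\; k\in(\mathbb{Z}/p\mathbb{Z})^{2n},\ \Lambda k=0 \pmod p\right\}.$$
   Context: $G_n$ is an undirected multigraph (multiple edges between vertices allowed) with vertex set $\{v_1,\dots,v_n\}$; its adjacency matrix $\Gamma$ is the $n\times n$ matrix with $\Gamma_{ij}$ equal to the number of edges between $v_i$ and $v_j$ (taken mod $p$), and $\Gamma_{ij}=0$ if there is no such edge. A labelling is an element $L=(L_1,\dots,L_n)\in(\mathbb{Z}/p\mathbb{Z})^n$. For each $i$ define maps $(\mathbb{Z}/p\mathbb{Z})^n\to(\mathbb{Z}/p\mathbb{Z})^n$: $Z_i$ replaces $L_i$ by $L_i+1\bmod p$, leaving other entries unchanged; $X_i$ replaces each $L_j$ by $L_j+\Gamma_{ij}\bmod p$ for all $1\le j\le n$. Let $\langle Z_i,X_i\rangle$ be the group of maps generated by $Z_i,X_i$ under composition and $I$ the identity map. For $O_i\in\langle Z_i,X_i\rangle$, $\eta(O_i)=1$ if $O_i\ne I$ and $\eta(O_i)=0$ if $O_i=I$. The diagonal distance is $$\Delta(G_n)=\min\left\{\sum_{i=1}^n\eta(O_i)>0 \;\middle|\;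 \prod_{i=1}^n O_i=I,\ O_i\in\langle Z_i,X_i\rangle,\ 1\le i\le n\right\},$$ with $\prod$ denoting composition. For $k=(k_1,\dots,k_{2n})$ and $1\le i\le n$, $\chi(k_i)=1$ if $k_i\ne0$ or $k_{i+n}\ne0$, and $\chi(k_i)=0$ otherwise. $I_n$ is the $n\times n$ identity matrix.
   Formalization: Every row of Γ has some entry $\Gamma_{ij}$ nonzero mod p, and the multigraph has no loops, so Γ is symmetric with zero diagonal. Each condition added here is assumed in the paper as well or is needed for the statement above to hold. -}

module Defs where

open import Data.Nat using (ℕ; zero; suc; _+_; _*_; _∸_; _≤_; _<_; NonZero)
open import Data.Nat.DivMod using (_mod_)
open import Data.Fin using (Fin; zero; suc; toℕ; _↑ˡ_; _↑ʳ_; splitAt; _≟_)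
open import Data.Bool using (Bool; true; false; if_then_else_)
open import Data.Sum using (inj₁; inj₂)
open import Data.Product using (Σ; _×_; _,_)
open import Function using (_∘_; id)
open import Function.Bundles using (_⇔_)
open import Relation.Nullary using (¬_; does)
open import Relation.Binary.PropositionalEquality using (_≡_)

-- Arithmetic in ℤ/pℤ, represented as Fin p

module _ {p : ℕ} .{{_ : NonZero p}} where

  0ₚ : Fin p
  0ₚ = 0 mod p

  1ₚ : Fin p
  1ₚ = 1 mod p

  _+ₚ_ : Fin p → Fin p → Fin p
  a +ₚ b = (toℕ a + toℕ b) mod p

  _*ₚ_ : Fin p → Fin p → Fin p
  a *ₚ b = (toℕ a * toℕ b) mod p

  -ₚ_ : Fin p → Fin p
  -ₚ a = (p ∸ toℕ a) mod p

  sumₚ : ∀ {m} → (Fin m → Fin p) → Fin p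
  sumₚ {zero}  f = 0ₚ
  sumₚ {suc m} f = f zero +ₚ sumₚ (f ∘ suc)

sumℕ : ∀ {m} → (Fin m → ℕ) → ℕ
sumℕ {zero}  f = 0
sumℕ {suc m} f = f zero + sumℕ (f ∘ suc)

Labelling : ℕ → ℕ → Set
Labelling p n = Fin n → Fin p

Map : ℕ → ℕ → Set
Map p n = Labelling p n → Labelling p n

_≈_ : ∀ {p n} → Map p n → Map p n → Set
f ≈ g = ∀ L j → f L j ≡ g L j

I : ∀ {p n} → Map p n
I = id

module _ {p : ℕ} .{{_ : NonZero p}} {n : ℕ} (Γ : Fin n → Fin n → Fin p) where

  Zop : Fin n → Map p n
  Zop i L j = if does (i ≟ j) then L j +ₚ 1ₚ else L j

  Zinv : Fin n → Map p n
  Zinv i L j = if does (i ≟ j) then L j +ₚ (-ₚ 1ₚ) else L j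

  Xop : Fin n → Map p n
  Xop i L j = L j +ₚ Γ i j

  Xinv : Fin n → Map p n
  Xinv i L j = L j +ₚ (-ₚ (Γ i j))

  data Word (i : Fin n) : Map p n → Set where
    w-id   : Word i I
    w-Z    : ∀ {f} → Word i f → Word i (Zop i ∘ f)
    w-Zinv : ∀ {f} → Word i f → Word i (Zinv i ∘ f)
    w-X    : ∀ {f} → Word i f → Word i (Xop i ∘ f)
    w-Xinv : ∀ {f} → Word i f → Word i (Xinv i ∘ f)

  InGroup : Fin n → Map p n → Set
  InGroup i O = Σ (Map p n) λ g → Word i g × (O ≈ g)

compose : ∀ {p n m} → (Fin m → Map p n) → Map p n
compose {m = zero}  O = I
compose {m = suc m} O = O zero ∘ compose (O ∘ suc)

countTrue : ∀ {m} → (Fin m → Bool) → ℕ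
countTrue s = sumℕ (λ i → if s i then 1 else 0)

SumEta : ∀ {p n} → (Fin n → Map p n) → ℕ → Set
SumEta {n = n} O d =
  Σ (Fin n → Bool) λ s → (∀ i → (s i ≡ true) ⇔ (¬ (O i ≈ I))) × (countTrue s ≡ d)

-- the set whose minimum is the diagonal distance Δ(G_n)
DiagSet : ∀ {p} .{{_ : NonZero p}} {n} → (Fin n → Fin n → Fin p) → ℕ → Set
DiagSet {p} {n = n} Γ d =
  Σ (Fin n → Map p n) λ O →
    (∀ i → InGroup Γ i (O i)) × (compose O ≈ I) × SumEta O d × (0 < d)

Λ : ∀ {p} .{{_ : NonZero p}} {n} → (Fin n → Fin n → Fin p) → Fin n → Fin (n + n) → Fin p
Λ {n = n} Γ r c with splitAt n c
... | inj₁ j = if does (r ≟ j) then 1ₚ else 0ₚ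
... | inj₂ j = Γ r j

KernelΛ : ∀ {p} .{{_ : NonZero p}} {n} → (Fin n → Fin n → Fin p) → (Fin (n + n) → Fin p) → Set
KernelΛ Γ k = ∀ r → sumₚ (λ c → Λ Γ r c *ₚ k c) ≡ 0ₚ

χ : ∀ {p} .{{_ : NonZero p}} {n} → (Fin (n + n) → Fin p) → Fin n → ℕ
χ {n = n} k i =
  if does (k (i ↑ˡ n) ≟ 0ₚ) then (if does (k (n ↑ʳ i) ≟ 0ₚ) then 0 else 1) else 1

KerSet : ∀ {p} .{{_ : NonZero p}} {n} → (Fin n → Fin n → Fin p) → ℕ → Set
KerSet {p} {n} Γ d =
  Σ (Fin (n + n) → Fin p) λ k → KernelΛ Γ k × (sumℕ (χ {n = n} k) ≡ d) × (0 < d)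

IsMin : (ℕ → Set) → ℕ → Set
IsMin S d = S d × (∀ e → S e → d ≤ e)

-- Every generator of ⟨Zᵢ, Xᵢ⟩ translates a labelling, so each element of ⟨Zᵢ, Xᵢ⟩ is the
-- translation Zᵢᵃ Xᵢᵇ by a·eᵢ + b·Γᵢ (Γᵢ the i-th row of Γ), and every pair (a, b) occurs.
-- Writing aᵢ = kᵢ and bᵢ = k_{n+i}, a product ∏ Oᵢ is the translation by Σᵢ (aᵢ eᵢ + bᵢ Γᵢ),
-- which by symmetry of Γ is Λk; so ∏ Oᵢ = I exactly when Λk = 0. Since Γᵢᵢ = 0 and
-- Γᵢ ≠ 0, primality of p shows aᵢ eᵢ + bᵢ Γᵢ = 0 only for aᵢ = bᵢ = 0, i.e. η(Oᵢ) = χ(kᵢ).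
-- Hence the two sets in the theorem coincide, and so do their minima.
module Submission where

open import Defs
open import Level using (0ℓ)
open import Algebra.Bundles using (AbelianGroup)
open import Algebra.Structures using (IsAbelianGroup)
import Algebra.Properties.AbelianGroup as AbelianGroupProperties
import Algebra.Properties.CommutativeSemigroup as CommutativeSemigroupProperties
open import Data.Bool using (Bool; true; false; if_then_else_)
open import Data.Bool.Properties using (if-eta; if-float)
open import Data.Empty using (⊥-elim)
open import Data.Fin using (Fin; zero; suc; toℕ; _↑ˡ_; _↑ʳ_; splitAt; _≟_)
open import Data.Fin.Properties using (toℕ-injective; toℕ-fromℕ<; toℕ<n; splitAt-↑ˡ; splitAt-↑ʳ)
open import Data.Nat using (ℕ; zero; suc; _+_; _*_; _∸_; NonZero; >-nonZero⁻¹)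
open import Data.Nat.DivMod
  using (_%_; _mod_; m%n<n; m%n%n≡m%n; m<n⇒m%n≡m; n%n≡0; %-distribˡ-+; %-distribˡ-*)
open import Data.Nat.Divisibility using (_∣_; m%n≡0⇒n∣m; n∣m⇒m%n≡0)
import Data.Nat.Properties as ℕ
open import Data.Nat.Primality using (Prime; euclidsLemma)
open import Data.Product using (Σ; _×_; _,_; proj₁; proj₂)
import Data.Sum as Sum
open Sum using (_⊎_; [_,_]′)
open import Function using (_∘_)
open import Function.Bundles using (_⇔_; mk⇔; Equivalence)
import Function.Properties.Equivalence as ⇔
open import Relation.Binary.PropositionalEquality
open import Relation.Binary.PropositionalEquality.Algebra using (isMagma)
open import Relation.Nullary using (¬_; Dec; does; yes; no; ¬?; _×-dec_; contradiction)
open import Relation.Nullary.Decidable using (dec-true)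

open Equivalence using (to; from)

does≡true⇔ : ∀ {P : Set} (P? : Dec P) → (does P? ≡ true) ⇔ P
does≡true⇔ P? = mk⇔ (witness P?) (dec-true P?)
  where
  witness : ∀ {P : Set} (P? : Dec P) → does P? ≡ true → P
  witness (yes p) _ = p
  witness (no _) ()

sumℕ-cong : ∀ {m} {f g : Fin m → ℕ} → (∀ i → f i ≡ g i) → sumℕ f ≡ sumℕ g
sumℕ-cong {zero}  f≡g = refl
sumℕ-cong {suc m} f≡g = cong₂ _+_ (f≡g zero) (sumℕ-cong (f≡g ∘ suc))

¬-cong-⇔ : ∀ {P Q : Set} → P ⇔ Q → (¬ P) ⇔ (¬ Q)
¬-cong-⇔ P⇔Q = mk⇔ (λ ¬P q → ¬P (from P⇔Q q)) (λ ¬Q p → ¬Q (to P⇔Q p))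

join : ∀ {A : Set} {n} → (Fin n → A) → (Fin n → A) → Fin (n + n) → A
join {n = n} a b c = [ a , b ]′ (splitAt n c)

join-↑ˡ : ∀ {A : Set} {n} (a b : Fin n → A) i → join a b (i ↑ˡ n) ≡ a i
join-↑ˡ {n = n} a b i rewrite splitAt-↑ˡ n i n = refl

join-↑ʳ : ∀ {A : Set} {n} (a b : Fin n → A) i → join a b (n ↑ʳ i) ≡ b i
join-↑ʳ {n = n} a b i rewrite splitAt-↑ʳ n n i = refl

IsMin-cong : ∀ {S T : ℕ → Set} → (∀ d → S d ⇔ T d) → ∀ d → IsMin S d ⇔ IsMin T d
IsMin-cong S⇔T d = mk⇔
  (λ (Sd , d≤S) → to (S⇔T d) Sd , λ e Te → d≤S e (from (S⇔T e) Te))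
  (λ (Td , d≤T) → from (S⇔T d) Td , λ e Se → d≤T e (to (S⇔T e) Se))

module ZMod {p : ℕ} .{{_ : NonZero p}} where

  infix 4 _≡ₘ_
  _≡ₘ_ : ℕ → ℕ → Set
  x ≡ₘ y = x % p ≡ y % p

  toℕ-mod : ∀ m → toℕ (m mod p) ≡ m % p
  toℕ-mod m = toℕ-fromℕ< (m%n<n m p)

  toℕ-mod-≡ₘ : ∀ m → toℕ (m mod p) ≡ₘ m
  toℕ-mod-≡ₘ m = trans (cong (_% p) (toℕ-mod m)) (m%n%n≡m%n m p)

  0%p≡0 : 0 % p ≡ 0
  0%p≡0 = m<n⇒m%n≡m (>-nonZero⁻¹ p)

  toℕ-0ₚ : toℕ (0ₚ {p}) ≡ 0
  toℕ-0ₚ = trans (toℕ-mod 0) 0%p≡0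

  ≡ₘ⇒≡ : ∀ {a b : Fin p} → toℕ a ≡ₘ toℕ b → a ≡ b
  ≡ₘ⇒≡ {a} {b} a≡ₘb = toℕ-injective (begin
    toℕ a      ≡⟨ m<n⇒m%n≡m (toℕ<n a) ⟨
    toℕ a % p  ≡⟨ a≡ₘb ⟩
    toℕ b % p  ≡⟨ m<n⇒m%n≡m (toℕ<n b) ⟩
    toℕ b      ∎)
    where open ≡-Reasoning

  ≡ₘ-lift : ∀ {a b : Fin p} {x y} → toℕ a ≡ₘ x → x ≡ y → toℕ b ≡ₘ y → a ≡ b
  ≡ₘ-lift a≡ₘx refl b≡ₘx = ≡ₘ⇒≡ (trans a≡ₘx (sym b≡ₘx))

  +ₚ-≡ₘ : ∀ (a b : Fin p) {x y} → toℕ a ≡ₘ x → toℕ b ≡ₘ y → toℕ (a +ₚ b) ≡ₘ x + y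
  +ₚ-≡ₘ a b {x} {y} a≡ₘx b≡ₘy = begin
    toℕ (a +ₚ b) % p             ≡⟨ toℕ-mod-≡ₘ (toℕ a + toℕ b) ⟩
    (toℕ a + toℕ b) % p          ≡⟨ %-distribˡ-+ (toℕ a) (toℕ b) p ⟩
    (toℕ a % p + toℕ b % p) % p  ≡⟨ cong₂ (λ u v → (u + v) % p) a≡ₘx b≡ₘy ⟩
    (x % p + y % p) % p          ≡⟨ %-distribˡ-+ x y p ⟨
    (x + y) % p                  ∎
    where open ≡-Reasoning

  *ₚ-≡ₘ : ∀ (a b : Fin p) {x y} → toℕ a ≡ₘ x → toℕ b ≡ₘ y → toℕ (a *ₚ b) ≡ₘ x * y
  *ₚ-≡ₘ a b {x} {y} a≡ₘx b≡ₘy = begin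
    toℕ (a *ₚ b) % p               ≡⟨ toℕ-mod-≡ₘ (toℕ a * toℕ b) ⟩
    (toℕ a * toℕ b) % p            ≡⟨ %-distribˡ-* (toℕ a) (toℕ b) p ⟩
    (toℕ a % p * (toℕ b % p)) % p  ≡⟨ cong₂ (λ u v → (u * v) % p) a≡ₘx b≡ₘy ⟩
    (x % p * (y % p)) % p          ≡⟨ %-distribˡ-* x y p ⟨
    (x * y) % p                    ∎
    where open ≡-Reasoning

  +ₚ-assoc : ∀ (a b c : Fin p) → (a +ₚ b) +ₚ c ≡ a +ₚ (b +ₚ c)
  +ₚ-assoc a b c = ≡ₘ-lift (+ₚ-≡ₘ (a +ₚ b) c (+ₚ-≡ₘ a b refl refl) refl)
    (ℕ.+-assoc (toℕ a) (toℕ b) (toℕ c)) (+ₚ-≡ₘ a (b +ₚ c) refl (+ₚ-≡ₘ b c refl refl))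

  +ₚ-comm : ∀ (a b : Fin p) → a +ₚ b ≡ b +ₚ a
  +ₚ-comm a b = ≡ₘ-lift (+ₚ-≡ₘ a b refl refl) (ℕ.+-comm (toℕ a) (toℕ b)) (+ₚ-≡ₘ b a refl refl)

  +ₚ-identityˡ : ∀ (a : Fin p) → 0ₚ +ₚ a ≡ a
  +ₚ-identityˡ a = ≡ₘ-lift (+ₚ-≡ₘ 0ₚ a (toℕ-mod-≡ₘ 0) refl) refl refl

  +ₚ-identityʳ : ∀ (a : Fin p) → a +ₚ 0ₚ ≡ a
  +ₚ-identityʳ a = trans (+ₚ-comm a 0ₚ) (+ₚ-identityˡ a)

  +ₚ-inverseʳ : ∀ (a : Fin p) → a +ₚ (-ₚ a) ≡ 0ₚ
  +ₚ-inverseʳ a = ≡ₘ-lift (+ₚ-≡ₘ a (-ₚ a) refl (toℕ-mod-≡ₘ (p ∸ toℕ a)))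
    (ℕ.m+[n∸m]≡n (ℕ.<⇒≤ (toℕ<n a)))
    (trans (toℕ-mod-≡ₘ 0) (trans 0%p≡0 (sym (n%n≡0 p))))

  +ₚ-inverseˡ : ∀ (a : Fin p) → (-ₚ a) +ₚ a ≡ 0ₚ
  +ₚ-inverseˡ a = trans (+ₚ-comm (-ₚ a) a) (+ₚ-inverseʳ a)

  *ₚ-comm : ∀ (a b : Fin p) → a *ₚ b ≡ b *ₚ a
  *ₚ-comm a b = ≡ₘ-lift (*ₚ-≡ₘ a b refl refl) (ℕ.*-comm (toℕ a) (toℕ b)) (*ₚ-≡ₘ b a refl refl)

  *ₚ-identityˡ : ∀ (a : Fin p) → 1ₚ *ₚ a ≡ a
  *ₚ-identityˡ a = ≡ₘ-lift (*ₚ-≡ₘ 1ₚ a (toℕ-mod-≡ₘ 1) refl) (ℕ.*-identityˡ (toℕ a)) refl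

  *ₚ-zeroˡ : ∀ (a : Fin p) → 0ₚ *ₚ a ≡ 0ₚ
  *ₚ-zeroˡ a = ≡ₘ-lift (*ₚ-≡ₘ 0ₚ a (toℕ-mod-≡ₘ 0) refl) refl (toℕ-mod-≡ₘ 0)

  *ₚ-zeroʳ : ∀ (a : Fin p) → a *ₚ 0ₚ ≡ 0ₚ
  *ₚ-zeroʳ a = trans (*ₚ-comm a 0ₚ) (*ₚ-zeroˡ a)

  *ₚ-distribʳ-+ₚ : ∀ (a b c : Fin p) → (a +ₚ b) *ₚ c ≡ (a *ₚ c) +ₚ (b *ₚ c)
  *ₚ-distribʳ-+ₚ a b c = ≡ₘ-lift (*ₚ-≡ₘ (a +ₚ b) c (+ₚ-≡ₘ a b refl refl) refl)
    (ℕ.*-distribʳ-+ (toℕ c) (toℕ a) (toℕ b))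
    (+ₚ-≡ₘ (a *ₚ c) (b *ₚ c) (*ₚ-≡ₘ a c refl refl) (*ₚ-≡ₘ b c refl refl))

  +ₚ-isAbelianGroup : IsAbelianGroup _≡_ _+ₚ_ 0ₚ -ₚ_
  +ₚ-isAbelianGroup = record
    { isGroup = record
      { isMonoid = record
        { isSemigroup = record { isMagma = isMagma _+ₚ_ ; assoc = +ₚ-assoc }
        ; identity    = +ₚ-identityˡ , +ₚ-identityʳ
        }
      ; inverse = +ₚ-inverseˡ , +ₚ-inverseʳ
      ; ⁻¹-cong = cong -ₚ_
      }
    ; comm = +ₚ-comm
    }

  +ₚ-abelianGroup : AbelianGroup 0ℓ 0ℓ
  +ₚ-abelianGroup = record { isAbelianGroup = +ₚ-isAbelianGroup }

  open AbelianGroupProperties +ₚ-abelianGroup public using (inverseʳ-unique)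
  open CommutativeSemigroupProperties (AbelianGroup.commutativeSemigroup +ₚ-abelianGroup) public
    using (interchange)

  -ₚ-as-*ₚ : ∀ (a : Fin p) → -ₚ a ≡ (-ₚ 1ₚ) *ₚ a
  -ₚ-as-*ₚ a = sym (inverseʳ-unique a ((-ₚ 1ₚ) *ₚ a) (begin
    a +ₚ ((-ₚ 1ₚ) *ₚ a)            ≡⟨ cong (_+ₚ ((-ₚ 1ₚ) *ₚ a)) (*ₚ-identityˡ a) ⟨
    (1ₚ *ₚ a) +ₚ ((-ₚ 1ₚ) *ₚ a)    ≡⟨ *ₚ-distribʳ-+ₚ 1ₚ (-ₚ 1ₚ) a ⟨
    (1ₚ +ₚ (-ₚ 1ₚ)) *ₚ a           ≡⟨ cong (_*ₚ a) (+ₚ-inverseʳ 1ₚ) ⟩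
    0ₚ *ₚ a                        ≡⟨ *ₚ-zeroˡ a ⟩
    0ₚ                             ∎))
    where open ≡-Reasoning

  p∣⇒≡0ₚ : ∀ {a : Fin p} → p ∣ toℕ a → a ≡ 0ₚ
  p∣⇒≡0ₚ {a} p∣a = toℕ-injective (begin
    toℕ a      ≡⟨ m<n⇒m%n≡m (toℕ<n a) ⟨
    toℕ a % p  ≡⟨ n∣m⇒m%n≡0 (toℕ a) p p∣a ⟩
    0          ≡⟨ toℕ-0ₚ ⟨
    toℕ 0ₚ     ∎)
    where open ≡-Reasoning

  a*b≡0⇒a≡0∨b≡0 : Prime p → ∀ (a b : Fin p) → a *ₚ b ≡ 0ₚ → a ≡ 0ₚ ⊎ b ≡ 0ₚ
  a*b≡0⇒a≡0∨b≡0 p-prime a b ab≡0 =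
    Sum.map p∣⇒≡0ₚ p∣⇒≡0ₚ (euclidsLemma (toℕ a) (toℕ b) p-prime p∣ab)
    where
    p∣ab : p ∣ toℕ a * toℕ b
    p∣ab = m%n≡0⇒n∣m _ p (trans (sym (toℕ-mod _)) (trans (cong toℕ ab≡0) toℕ-0ₚ))

  1ₚ+ₚmod : ∀ m → 1ₚ +ₚ (m mod p) ≡ suc m mod p
  1ₚ+ₚmod m = ≡ₘ-lift (+ₚ-≡ₘ 1ₚ (m mod p) (toℕ-mod-≡ₘ 1) (toℕ-mod-≡ₘ m)) refl (toℕ-mod-≡ₘ (suc m))

  toℕ-mod-inverse : ∀ (a : Fin p) → toℕ a mod p ≡ a
  toℕ-mod-inverse a = ≡ₘ⇒≡ (toℕ-mod-≡ₘ (toℕ a))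

  sumₚ-cong : ∀ {m} {f g : Fin m → Fin p} → (∀ i → f i ≡ g i) → sumₚ f ≡ sumₚ g
  sumₚ-cong {zero}  f≡g = refl
  sumₚ-cong {suc m} f≡g = cong₂ _+ₚ_ (f≡g zero) (sumₚ-cong (f≡g ∘ suc))

  sumₚ-+ₚ : ∀ {m} (f g : Fin m → Fin p) → sumₚ (λ i → f i +ₚ g i) ≡ sumₚ f +ₚ sumₚ g
  sumₚ-+ₚ {zero}  f g = sym (+ₚ-identityˡ 0ₚ)
  sumₚ-+ₚ {suc m} f g = trans (cong ((f zero +ₚ g zero) +ₚ_) (sumₚ-+ₚ (f ∘ suc) (g ∘ suc)))
    (interchange (f zero) (g zero) (sumₚ (f ∘ suc)) (sumₚ (g ∘ suc)))

  sumₚ-split : ∀ m k (f : Fin (m + k) → Fin p) →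
    sumₚ f ≡ sumₚ (λ i → f (i ↑ˡ k)) +ₚ sumₚ (λ j → f (m ↑ʳ j))
  sumₚ-split zero    k f = sym (+ₚ-identityˡ _)
  sumₚ-split (suc m) k f = trans (cong (f zero +ₚ_) (sumₚ-split m k (f ∘ suc))) (sym (+ₚ-assoc _ _ _))

  -- The right-hand side is χ(kᵢ) unfolded, with a = kᵢ and b = k_{n+i}.
  indicator≡χ : ∀ (s : Bool) (a b : Fin p) → (s ≡ true) ⇔ (¬ (a ≡ 0ₚ × b ≡ 0ₚ)) →
    (if s then 1 else 0) ≡ (if does (a ≟ 0ₚ) then (if does (b ≟ 0ₚ) then 0 else 1) else 1)
  indicator≡χ s a b s⇔ with a ≟ 0ₚ | b ≟ 0ₚ | s
  ... | yes a≡0 | yes b≡0 | true  = ⊥-elim (to s⇔ refl (a≡0 , b≡0))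
  ... | yes _   | yes _   | false = refl
  ... | yes _   | no b≢0  | true  = refl
  ... | yes _   | no b≢0  | false = contradiction (from s⇔ (λ (_ , b≡0) → b≢0 b≡0)) λ ()
  ... | no _    | _       | true  = refl
  ... | no a≢0  | _       | false = contradiction (from s⇔ (λ (a≡0 , _) → a≢0 a≡0)) λ ()

module Translations {p : ℕ} .{{_ : NonZero p}} {n : ℕ} where
  open ZMod

  translation : (Fin n → Fin p) → Map p n
  translation t L j = L j +ₚ t j

  ≈-trans : ∀ {f g h : Map p n} → f ≈ g → g ≈ h → f ≈ h
  ≈-trans f≈g g≈h L j = trans (f≈g L j) (g≈h L j)

  translation-cong : ∀ {f : Map p n} {s t} → (∀ j → s j ≡ t j) → f ≈ translation s → f ≈ translation t
  translation-cong s≡t f≈s L j = trans (f≈s L j) (cong (L j +ₚ_) (s≡t j))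

  translation-∘ : ∀ {f g : Map p n} {s t} → g ≈ translation s → f ≈ translation t →
    (g ∘ f) ≈ translation (λ j → s j +ₚ t j)
  translation-∘ {f} {g} {s} {t} g≈s f≈t L j = begin
    g (f L) j            ≡⟨ g≈s (f L) j ⟩
    f L j +ₚ s j         ≡⟨ cong (_+ₚ s j) (f≈t L j) ⟩
    (L j +ₚ t j) +ₚ s j  ≡⟨ +ₚ-assoc (L j) (t j) (s j) ⟩
    L j +ₚ (t j +ₚ s j)  ≡⟨ cong (L j +ₚ_) (+ₚ-comm (t j) (s j)) ⟩
    L j +ₚ (s j +ₚ t j)  ∎
    where open ≡-Reasoning

  compose-translation : ∀ {m} {O : Fin m → Map p n} {t : Fin m → Fin n → Fin p} →
    (∀ i → O i ≈ translation (t i)) → compose O ≈ translation (λ j → sumₚ (λ i → t i j))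
  compose-translation {zero}  _    L j = sym (+ₚ-identityʳ (L j))
  compose-translation {suc m} O≈t = translation-∘ (O≈t zero) (compose-translation (O≈t ∘ suc))

  translation-trivial⇔ : ∀ {f : Map p n} {t} → f ≈ translation t → (f ≈ I) ⇔ (∀ j → t j ≡ 0ₚ)
  translation-trivial⇔ {f} {t} f≈t = mk⇔ t≡0 f≈I
    where
    t≡0 : f ≈ I → ∀ j → t j ≡ 0ₚ
    t≡0 f≈I j = trans (sym (+ₚ-identityˡ (t j))) (trans (sym (f≈t (λ _ → 0ₚ) j)) (f≈I (λ _ → 0ₚ) j))
    f≈I : (∀ j → t j ≡ 0ₚ) → f ≈ I
    f≈I t≡0 L j = trans (f≈t L j) (trans (cong (L j +ₚ_) (t≡0 j)) (+ₚ-identityʳ (L j)))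

module Generators {p : ℕ} .{{_ : NonZero p}} {n : ℕ} (Γ : Fin n → Fin n → Fin p) where
  open ZMod
  open Translations

  -- shift i a b = a·eᵢ + b·Γᵢ, the translation performed by Zᵢᵃ Xᵢᵇ.
  shift : Fin n → Fin p → Fin p → Fin n → Fin p
  shift i a b j = (if does (i ≟ j) then a else 0ₚ) +ₚ (b *ₚ Γ i j)

  shift-0ₚ-b : ∀ i b j → shift i 0ₚ b j ≡ b *ₚ Γ i j
  shift-0ₚ-b i b j = trans (cong (_+ₚ (b *ₚ Γ i j)) (if-eta (does (i ≟ j)))) (+ₚ-identityˡ _)

  shift-a-0ₚ : ∀ i a j → shift i a 0ₚ j ≡ (if does (i ≟ j) then a else 0ₚ)
  shift-a-0ₚ i a j = trans (cong (_ +ₚ_) (*ₚ-zeroˡ (Γ i j))) (+ₚ-identityʳ _)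

  shift-+ₚ : ∀ i a b a′ b′ j → shift i a b j +ₚ shift i a′ b′ j ≡ shift i (a +ₚ a′) (b +ₚ b′) j
  shift-+ₚ i a b a′ b′ j = trans
    (interchange (if does (i ≟ j) then a else 0ₚ) (b *ₚ Γ i j) (if does (i ≟ j) then a′ else 0ₚ) (b′ *ₚ Γ i j))
    (cong₂ _+ₚ_ (if-+ₚ (does (i ≟ j))) (sym (*ₚ-distribʳ-+ₚ b b′ (Γ i j))))
    where
    if-+ₚ : ∀ c → (if c then a else 0ₚ) +ₚ (if c then a′ else 0ₚ) ≡ (if c then a +ₚ a′ else 0ₚ)
    if-+ₚ true  = refl
    if-+ₚ false = +ₚ-identityˡ 0ₚ

  shift-0ₚ-0ₚ : ∀ i j → shift i 0ₚ 0ₚ j ≡ 0ₚ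
  shift-0ₚ-0ₚ i j = trans (shift-0ₚ-b i 0ₚ j) (*ₚ-zeroˡ (Γ i j))

  shift-diagonal : ∀ i a b → Γ i i ≡ 0ₚ → shift i a b i ≡ a
  shift-diagonal i a b Γᵢᵢ≡0 = begin
    shift i a b i                                     ≡⟨⟩
    (if does (i ≟ i) then a else 0ₚ) +ₚ (b *ₚ Γ i i)  ≡⟨ cong₂ (λ c x → (if c then a else 0ₚ) +ₚ (b *ₚ x))
                                                           (dec-true (i ≟ i) refl) Γᵢᵢ≡0 ⟩
    a +ₚ (b *ₚ 0ₚ)                                    ≡⟨ cong (a +ₚ_) (*ₚ-zeroʳ b) ⟩
    a +ₚ 0ₚ                                           ≡⟨ +ₚ-identityʳ a ⟩
    a                                                 ∎
    where open ≡-Reasoning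

  shift-∘ : ∀ {i} a′ b′ a b {g h : Map p n} →
    h ≈ translation (shift i a′ b′) → g ≈ translation (shift i a b) →
    (h ∘ g) ≈ translation (shift i (a′ +ₚ a) (b′ +ₚ b))
  shift-∘ {i} a′ b′ a b h≈ g≈ =
    translation-cong (shift-+ₚ i a′ b′ a b) (translation-∘ h≈ g≈)

  I≈shift : ∀ i → I ≈ translation (shift i 0ₚ 0ₚ)
  I≈shift i L j = sym (trans (cong (L j +ₚ_) (shift-0ₚ-0ₚ i j)) (+ₚ-identityʳ (L j)))

  addAt≈shift : ∀ i x → (λ L j → if does (i ≟ j) then L j +ₚ x else L j) ≈ translation (shift i x 0ₚ)
  addAt≈shift i x L j = sym (begin
    L j +ₚ shift i x 0ₚ j                              ≡⟨ cong (L j +ₚ_) (shift-a-0ₚ i x j) ⟩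
    L j +ₚ (if c then x else 0ₚ)                       ≡⟨ if-float (L j +ₚ_) c ⟩
    (if c then L j +ₚ x else L j +ₚ 0ₚ)                ≡⟨ cong (if c then L j +ₚ x else_) (+ₚ-identityʳ (L j)) ⟩
    (if c then L j +ₚ x else L j)                      ∎)
    where
    open ≡-Reasoning
    c = does (i ≟ j)

  Zop≈shift : ∀ i → Zop Γ i ≈ translation (shift i 1ₚ 0ₚ)
  Zop≈shift i = addAt≈shift i 1ₚ

  Zinv≈shift : ∀ i → Zinv Γ i ≈ translation (shift i (-ₚ 1ₚ) 0ₚ)
  Zinv≈shift i = addAt≈shift i (-ₚ 1ₚ)

  Xop≈shift : ∀ i → Xop Γ i ≈ translation (shift i 0ₚ 1ₚ)
  Xop≈shift i L j = cong (L j +ₚ_) (sym (trans (shift-0ₚ-b i 1ₚ j) (*ₚ-identityˡ (Γ i j))))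

  Xinv≈shift : ∀ i → Xinv Γ i ≈ translation (shift i 0ₚ (-ₚ 1ₚ))
  Xinv≈shift i L j = cong (L j +ₚ_) (trans (-ₚ-as-*ₚ (Γ i j)) (sym (shift-0ₚ-b i (-ₚ 1ₚ) j)))

  IsShift : Fin n → Map p n → Set
  IsShift i g = Σ (Fin p) λ a → Σ (Fin p) λ b → g ≈ translation (shift i a b)

  IsShift-∘ : ∀ {i} a′ b′ {g h : Map p n} → h ≈ translation (shift i a′ b′) → IsShift i g → IsShift i (h ∘ g)
  IsShift-∘ a′ b′ h≈ (a , b , g≈) = a′ +ₚ a , b′ +ₚ b , shift-∘ a′ b′ a b h≈ g≈

  word⇒IsShift : ∀ {i g} → Word Γ i g → IsShift i g
  word⇒IsShift {i} w-id       = 0ₚ , 0ₚ , I≈shift i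
  word⇒IsShift {i} (w-Z w)    = IsShift-∘ 1ₚ 0ₚ (Zop≈shift i) (word⇒IsShift w)
  word⇒IsShift {i} (w-Zinv w) = IsShift-∘ (-ₚ 1ₚ) 0ₚ (Zinv≈shift i) (word⇒IsShift w)
  word⇒IsShift {i} (w-X w)    = IsShift-∘ 0ₚ 1ₚ (Xop≈shift i) (word⇒IsShift w)
  word⇒IsShift {i} (w-Xinv w) = IsShift-∘ 0ₚ (-ₚ 1ₚ) (Xinv≈shift i) (word⇒IsShift w)

  ShiftWord : Fin n → Fin p → Fin p → Set
  ShiftWord i a b = Σ (Map p n) λ g → Word Γ i g × g ≈ translation (shift i a b)

  ShiftWord-∘ : ∀ {i} a′ b′ a b {h : Map p n} → (∀ {g} → Word Γ i g → Word Γ i (h ∘ g)) →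
    h ≈ translation (shift i a′ b′) → ShiftWord i a b → ShiftWord i (a′ +ₚ a) (b′ +ₚ b)
  ShiftWord-∘ a′ b′ a b {h} prefix h≈ (g , w , g≈) = h ∘ g , prefix w , shift-∘ a′ b′ a b h≈ g≈

  powerWord : ∀ i (m m′ : ℕ) → ShiftWord i (m mod p) (m′ mod p)
  powerWord i zero    zero     = I , w-id , I≈shift i
  powerWord i zero    (suc m′) = subst₂ (ShiftWord i) (+ₚ-identityˡ 0ₚ) (1ₚ+ₚmod m′)
    (ShiftWord-∘ 0ₚ 1ₚ 0ₚ (m′ mod p) w-X (Xop≈shift i) (powerWord i zero m′))
  powerWord i (suc m) m′       = subst₂ (ShiftWord i) (1ₚ+ₚmod m) (+ₚ-identityˡ (m′ mod p))
    (ShiftWord-∘ 1ₚ 0ₚ (m mod p) (m′ mod p) w-Z (Zop≈shift i) (powerWord i m m′))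

  shiftWord : ∀ i a b → ShiftWord i a b
  shiftWord i a b = subst₂ (ShiftWord i) (toℕ-mod-inverse a) (toℕ-mod-inverse b) (powerWord i (toℕ a) (toℕ b))

  InGroup⇒IsShift : ∀ {i O} → InGroup Γ i O → IsShift i O
  InGroup⇒IsShift (g , w , O≈g) = let a , b , g≈ = word⇒IsShift w in a , b , ≈-trans O≈g g≈

  shift≡0⇔ : Prime p → (∀ i → Γ i i ≡ 0ₚ) → (∀ i → Σ (Fin n) λ j → ¬ Γ i j ≡ 0ₚ) →
    ∀ i a b → (∀ j → shift i a b j ≡ 0ₚ) ⇔ (a ≡ 0ₚ × b ≡ 0ₚ)
  shift≡0⇔ p-prime loopless noIsolated i a b = mk⇔ vanishing (λ { (refl , refl) → shift-0ₚ-0ₚ i })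
    where
    vanishing : (∀ j → shift i a b j ≡ 0ₚ) → a ≡ 0ₚ × b ≡ 0ₚ
    vanishing shift≡0 = a≡0 , b≡0
      where
      j = proj₁ (noIsolated i)
      a≡0 : a ≡ 0ₚ
      a≡0 = trans (sym (shift-diagonal i a b (loopless i))) (shift≡0 i)
      bΓᵢⱼ≡0 : b *ₚ Γ i j ≡ 0ₚ
      bΓᵢⱼ≡0 = trans (sym (shift-0ₚ-b i b j)) (trans (cong (λ x → shift i x b j) (sym a≡0)) (shift≡0 j))
      b≡0 : b ≡ 0ₚ
      b≡0 = Sum.fromInj₁ (⊥-elim ∘ proj₂ (noIsolated i)) (a*b≡0⇒a≡0∨b≡0 p-prime b (Γ i j) bΓᵢⱼ≡0)

  Λ-↑ˡ : ∀ r j → Λ Γ r (j ↑ˡ n) ≡ (if does (r ≟ j) then 1ₚ else 0ₚ)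
  Λ-↑ˡ r j rewrite splitAt-↑ˡ n j n = refl

  Λ-↑ʳ : ∀ r j → Λ Γ r (n ↑ʳ j) ≡ Γ r j
  Λ-↑ʳ r j rewrite splitAt-↑ʳ n n j = refl

  indicator-*ₚ : ∀ (r i : Fin n) x → (if does (r ≟ i) then 1ₚ else 0ₚ) *ₚ x ≡ (if does (i ≟ r) then x else 0ₚ)
  indicator-*ₚ r i x with r ≟ i | i ≟ r
  ... | yes _   | yes _   = *ₚ-identityˡ x
  ... | no _    | no _    = *ₚ-zeroˡ x
  ... | yes r≡i | no i≢r  = ⊥-elim (i≢r (sym r≡i))
  ... | no r≢i  | yes i≡r = ⊥-elim (r≢i (sym i≡r))

  Λ-row : (∀ i j → Γ i j ≡ Γ j i) → ∀ (k : Fin (n + n) → Fin p) r →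
    sumₚ (λ c → Λ Γ r c *ₚ k c) ≡ sumₚ (λ i → shift i (k (i ↑ˡ n)) (k (n ↑ʳ i)) r)
  Λ-row symmetric k r = begin
    sumₚ (λ c → Λ Γ r c *ₚ k c)
      ≡⟨ sumₚ-split n n (λ c → Λ Γ r c *ₚ k c) ⟩
    sumₚ (λ i → Λ Γ r (i ↑ˡ n) *ₚ k (i ↑ˡ n)) +ₚ sumₚ (λ i → Λ Γ r (n ↑ʳ i) *ₚ k (n ↑ʳ i))
      ≡⟨ cong₂ _+ₚ_ (sumₚ-cong identityPart) (sumₚ-cong adjacencyPart) ⟩
    sumₚ (λ i → if does (i ≟ r) then k (i ↑ˡ n) else 0ₚ) +ₚ sumₚ (λ i → k (n ↑ʳ i) *ₚ Γ i r)
      ≡⟨ sumₚ-+ₚ (λ i → if does (i ≟ r) then k (i ↑ˡ n) else 0ₚ) (λ i → k (n ↑ʳ i) *ₚ Γ i r) ⟨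
    sumₚ (λ i → shift i (k (i ↑ˡ n)) (k (n ↑ʳ i)) r)
      ∎
    where
    open ≡-Reasoning
    identityPart : ∀ i → Λ Γ r (i ↑ˡ n) *ₚ k (i ↑ˡ n) ≡ (if does (i ≟ r) then k (i ↑ˡ n) else 0ₚ)
    identityPart i = trans (cong (_*ₚ k (i ↑ˡ n)) (Λ-↑ˡ r i)) (indicator-*ₚ r i (k (i ↑ˡ n)))
    adjacencyPart : ∀ i → Λ Γ r (n ↑ʳ i) *ₚ k (n ↑ʳ i) ≡ k (n ↑ʳ i) *ₚ Γ i r
    adjacencyPart i = trans (cong (_*ₚ k (n ↑ʳ i)) (Λ-↑ʳ r i))
      (trans (*ₚ-comm (Γ r i) (k (n ↑ʳ i))) (cong (k (n ↑ʳ i) *ₚ_) (symmetric r i)))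

module _ {p : ℕ} .{{_ : NonZero p}} {n : ℕ} (Γ : Fin n → Fin n → Fin p) where
  open ZMod
  open Translations
  open Generators Γ

  Realises : (Fin n → Map p n) → (Fin (n + n) → Fin p) → Set
  Realises O k = ∀ i → O i ≈ translation (shift i (k (i ↑ˡ n)) (k (n ↑ʳ i)))

  realisation : ∀ {O} → (∀ i → InGroup Γ i (O i)) → Σ (Fin (n + n) → Fin p) (Realises O)
  realisation {O} O∈ = join a b , O≈
    where
    a b : Fin n → Fin p
    a i = proj₁ (InGroup⇒IsShift (O∈ i))
    b i = proj₁ (proj₂ (InGroup⇒IsShift (O∈ i)))
    O≈ : Realises O (join a b)
    O≈ i = translation-cong (λ j → cong₂ (λ x y → shift i x y j) (sym (join-↑ˡ a b i)) (sym (join-↑ʳ a b i)))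
      (proj₂ (proj₂ (InGroup⇒IsShift (O∈ i))))

  realisable : ∀ k → Σ (Fin n → Map p n) λ O → (∀ i → InGroup Γ i (O i)) × Realises O k
  realisable k = O , (λ i → O i , proj₁ (proj₂ (word i)) , λ _ _ → refl) , λ i → proj₂ (proj₂ (word i))
    where
    word : ∀ i → ShiftWord i (k (i ↑ˡ n)) (k (n ↑ʳ i))
    word i = shiftWord i (k (i ↑ˡ n)) (k (n ↑ʳ i))
    O : Fin n → Map p n
    O i = proj₁ (word i)

  compose≈I⇔KernelΛ : (∀ i j → Γ i j ≡ Γ j i) → ∀ {O} k → Realises O k → (compose O ≈ I) ⇔ KernelΛ Γ k
  compose≈I⇔KernelΛ symmetric k O≈ = ⇔.trans (translation-trivial⇔ (compose-translation O≈))
    (mk⇔ (λ sum≡0 r → trans (Λ-row symmetric k r) (sum≡0 r))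
         (λ Λk≡0 r → trans (sym (Λ-row symmetric k r)) (Λk≡0 r)))

  module _ (p-prime : Prime p) (loopless : ∀ i → Γ i i ≡ 0ₚ)
           (noIsolated : ∀ i → Σ (Fin n) λ j → ¬ Γ i j ≡ 0ₚ) where

    trivial⇔ : ∀ {O} k → Realises O k → ∀ i → (O i ≈ I) ⇔ (k (i ↑ˡ n) ≡ 0ₚ × k (n ↑ʳ i) ≡ 0ₚ)
    trivial⇔ k O≈ i = ⇔.trans (translation-trivial⇔ (O≈ i)) (shift≡0⇔ p-prime loopless noIsolated i _ _)

    countTrue≡weight : ∀ {O} k → Realises O k → ∀ {s} → (∀ i → (s i ≡ true) ⇔ (¬ O i ≈ I)) →
      countTrue s ≡ sumℕ (χ {n = n} k)
    countTrue≡weight k O≈ {s} s⇔ = sumℕ-cong λ i →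
      indicator≡χ (s i) _ _ (⇔.trans (s⇔ i) (¬-cong-⇔ (trivial⇔ k O≈ i)))

    DiagSet⇔KerSet : (∀ i j → Γ i j ≡ Γ j i) → ∀ d → DiagSet Γ d ⇔ KerSet Γ d
    DiagSet⇔KerSet symmetric d = mk⇔ diag⇒ker ker⇒diag
      where
      diag⇒ker : DiagSet Γ d → KerSet Γ d
      diag⇒ker (O , O∈ , ∏O≈I , (s , s⇔ , count) , d>0) =
        let k , O≈ = realisation O∈
        in k , to (compose≈I⇔KernelΛ symmetric k O≈) ∏O≈I , trans (sym (countTrue≡weight k O≈ s⇔)) count , d>0
      ker⇒diag : KerSet Γ d → DiagSet Γ d
      ker⇒diag (k , Λk≡0 , weight , d>0) =
        let O , O∈ , O≈ = realisable k
            nonzero? i = ¬? ((k (i ↑ˡ n) ≟ 0ₚ) ×-dec (k (n ↑ʳ i) ≟ 0ₚ))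
            s i = does (nonzero? i)
            s⇔ i = ⇔.trans (does≡true⇔ (nonzero? i)) (¬-cong-⇔ (⇔.sym (trivial⇔ k O≈ i)))
        in O , O∈ , from (compose≈I⇔KernelΛ symmetric k O≈) Λk≡0
             , (s , s⇔ , trans (countTrue≡weight k O≈ s⇔) weight) , d>0

theorem2 : (p : ℕ) .{{_ : NonZero p}} → Prime p →
    (n : ℕ) (Γ : Fin n → Fin n → Fin p) →
    (∀ i j → Γ i j ≡ Γ j i) →
    (∀ i → Γ i i ≡ 0ₚ) →
    (∀ i → Σ (Fin n) λ j → ¬ (Γ i j ≡ 0ₚ)) →
    ∀ d → IsMin (DiagSet Γ) d ⇔ IsMin (KerSet Γ) d
theorem2 p p-prime n Γ symmetric loopless noIsolated =
  IsMin-cong (DiagSet⇔KerSet Γ p-prime loopless noIsolated symmetric)
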